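{- For every integer $r>1$, $$n_2^*(2r)\le 4n_2(r-1)+4,\qquad n_2^*(2r+1)\le 2n_2(r-1)+2n_2(r)+4.$$
   Context: For a set of integers $A$, $2A=A+A=\{a+a':a,a'\in A\}$ and $[c,d]=\{c,\ldots,d\}$. A basis of length $m$ is a set of integers $A_m=\{0=a_0<a_1<\cdots<a_m\}$; its range $n_2(A_m)$ is the largest $n$ with $2A_m\supseteq[0,n]$. The basis is restricted if $n_2(A_m)\ge 2a_m$. $n_2(m)$ denotes the maximum range over all bases of length $m$, and $n_2^*(m)$ denotes the maximum range over all restricted bases of length $m$ (the extremal restricted range). -}

module Defs where

open import Data.Nat using (ℕ; zero; suc; _+_; _*_; _≤_; _<_)
open import Data.Fin as Fin using (Fin; fromℕ)
open import Data.Product using (Σ; ∃; _×_)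
open import Relation.Binary.PropositionalEquality using (_≡_)

record Basis (m : ℕ) : Set where
  field
    elt        : Fin (suc m) → ℕ
    elt-zero   : elt Fin.zero ≡ 0
    increasing : ∀ (i j : Fin (suc m)) → i Fin.< j → elt i < elt j
open Basis public

top : ∀ {m} → Basis m → ℕ
top {m} A = elt A (fromℕ m)

InSumset : ∀ {m} → Basis m → ℕ → Set
InSumset {m} A k = Σ (Fin (suc m)) λ i → Σ (Fin (suc m)) λ j → elt A i + elt A j ≡ k

Covers : ∀ {m} → Basis m → ℕ → Set
Covers A n = ∀ k → k ≤ n → InSumset A k

IsRange : ∀ {m} → Basis m → ℕ → Set
IsRange A n = Covers A n × (∀ n' → Covers A n' → n' ≤ n)

Restricted : ∀ {m} → Basis m → Set
Restricted A = ∀ n → IsRange A n → 2 * top A ≤ n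

IsN2 : ℕ → ℕ → Set
IsN2 m N = (Σ (Basis m) λ A → IsRange A N)
         × (∀ (A : Basis m) n → IsRange A n → n ≤ N)

IsN2* : ℕ → ℕ → Set
IsN2* m N = (Σ (Basis m) λ A → Restricted A × IsRange A N)
          × (∀ (A : Basis m) → Restricted A → ∀ n → IsRange A n → n ≤ N)

module Submission where

-- Let A = {0 = a_0 < ⋯ < a_m} be a restricted basis with range s.  Being
-- restricted, 2A contains all of [0, 2a_m]; in particular s ≤ 2a_m, since
-- no sum exceeds 2a_m.  Split m = p + q with p, q ≥ 1.
--  * Prefix bound: a number below a_p is a sum of two elements below a_p,
--    i.e. of two elements of the prefix basis {a_0, …, a_{p-1}}; hence
--    [0, a_p) lies in the sumset of a basis of length p - 1, and
--    a_p ≤ n₂(p - 1) + 1.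
--  * Suffix bound: the reflection {a_m - a_i} is again a basis with top a_m
--    whose sumset contains [0, 2a_m], and a_m - a_p sits at position q in it,
--    so the prefix bound gives a_m - a_p ≤ n₂(q - 1) + 1.
-- Adding, s ≤ 2a_m ≤ 2(n₂(p - 1) + n₂(q - 1) + 2).  Corollary 7 is the
-- instance of this split bound for 2r = r + r and 2r + 1 = r + (r + 1).
-- The file proves, in order: order facts about bases, existence of the range
-- n₂(A), prefix and reflected bases with the two bounds, the split bound,
-- and the corollary.

open import Defs
open import Data.Nat using (ℕ; zero; suc; _+_; _*_; _∸_; _≤_; _<_; z≤n; s≤s; _≟_)
open import Data.Nat.Properties
open import Data.Nat.Tactic.RingSolver using (solve-∀)
open import Data.Fin as Fin using (Fin; toℕ; fromℕ; fromℕ<; inject≤; opposite)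
open import Data.Fin.Properties
  using (toℕ-injective; toℕ≤pred[n]; toℕ-fromℕ; toℕ-fromℕ<; toℕ-inject≤;
         opposite-prop; opposite-involutive; any?)
open import Data.Product using (Σ; _×_; _,_)
open import Data.Sum using (_⊎_; inj₁; inj₂)
open import Data.Empty using (⊥-elim)
open import Relation.Nullary using (Dec; yes; no; ¬_)
open import Relation.Binary.PropositionalEquality

elt-mono : ∀ {m} (A : Basis m) {i j : Fin (suc m)} → toℕ i ≤ toℕ j → elt A i ≤ elt A j
elt-mono A {i} {j} i≤j with m≤n⇒m<n∨m≡n i≤j
... | inj₁ i<j = <⇒≤ (increasing A i j i<j)
... | inj₂ i≡j = ≤-reflexive (cong (elt A) (toℕ-injective i≡j))

elt-reflects-< : ∀ {m} (A : Basis m) {i j : Fin (suc m)} → elt A i < elt A j → toℕ i < toℕ j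
elt-reflects-< A ai<aj = ≰⇒> (λ j≤i → <⇒≱ ai<aj (elt-mono A j≤i))

elt≤top : ∀ {m} (A : Basis m) (i : Fin (suc m)) → elt A i ≤ top A
elt≤top {m} A i = elt-mono A (≤-trans (toℕ≤pred[n] i) (≤-reflexive (sym (toℕ-fromℕ m))))

sumset≤2top : ∀ {m} (A : Basis m) {k} → InSumset A k → k ≤ 2 * top A
sumset≤2top A (i , j , refl) =
  ≤-trans (+-mono-≤ (elt≤top A i) (elt≤top A j))
          (≤-reflexive (cong (top A +_) (sym (+-identityʳ (top A)))))

inSumset? : ∀ {m} (A : Basis m) k → Dec (InSumset A k)
inSumset? A k = any? (λ i → any? (λ j → elt A i + elt A j ≟ k))

module FirstFailure {P : ℕ → Set} (P? : ∀ k → Dec (P k)) where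

  HoldsBelow : ℕ → Set
  HoldsBelow g = ∀ {k} → k < g → P k

  holds-or-fails-below : ∀ b → HoldsBelow b ⊎ Σ ℕ λ g → HoldsBelow g × ¬ P g
  holds-or-fails-below zero = inj₁ λ ()
  holds-or-fails-below (suc b) with holds-or-fails-below b | P? b
  ... | inj₂ failure | _      = inj₂ failure
  ... | inj₁ below   | no ¬pb = inj₂ (b , below , ¬pb)
  ... | inj₁ below   | yes pb = inj₁ extended
    where
    extended : HoldsBelow (suc b)
    extended k<1+b with m≤n⇒m<n∨m≡n (m<1+n⇒m≤n k<1+b)
    ... | inj₁ k<b  = below k<b
    ... | inj₂ refl = pb

  firstFailure : ∀ b → ¬ P b → Σ ℕ λ g → HoldsBelow g × ¬ P g
  firstFailure b ¬pb with holds-or-fails-below b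
  ... | inj₁ below   = b , below , ¬pb
  ... | inj₂ failure = failure

open FirstFailure using (firstFailure)

-- Every basis has a range n₂(A): the number just before the first gap of 2A.
-- Such a gap exists because 2 a_m + 1 ∉ 2A, and it is not 0 because 0 = a_0 + a_0.
range : ∀ {m} (A : Basis m) → Σ ℕ (IsRange A)
range A with firstFailure (inSumset? A) (suc (2 * top A)) (λ p → 1+n≰n (sumset≤2top A p))
... | zero  , _     , 0∉2A = ⊥-elim (0∉2A (Fin.zero , Fin.zero , cong₂ _+_ (elt-zero A) (elt-zero A)))
... | suc n , below , gap  =
  n , (λ k k≤n → below (s≤s k≤n)) , (λ n' covers → ≮⇒≥ (λ n<n' → gap (covers (suc n) n<n')))

below-range-bound : ∀ {k} (B : Basis k) {c N} →
  (∀ d → d < c → InSumset B d) → IsN2 k N → c ≤ suc N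
below-range-bound B {zero}  _      _             = z≤n
below-range-bound B {suc e} covers (_ , maximal) with range B
... | n , rangeB@(_ , n-largest) =
  s≤s (≤-trans (n-largest e (λ d d≤e → covers d (s≤s d≤e))) (maximal B n rangeB))

Full : ∀ {m} → Basis m → Set
Full A = Covers A (2 * top A)

prefix : ∀ {m} (A : Basis m) k → k ≤ m → Basis k
prefix A k k≤m = record
  { elt        = λ i → elt A (inject≤ i (s≤s k≤m))
  ; elt-zero   = elt-zero A
  ; increasing = λ i j i<j → increasing A _ _
      (subst₂ _<_ (sym (toℕ-inject≤ i _)) (sym (toℕ-inject≤ j _)) i<j)
  }

-- Fix a basis A of length m and the index x of position k + 1, with prefix
-- P = {a_0, …, a_k}; everything below a_x in A already belongs to P.
module PrefixBound {m} (A : Basis m) {k} (x : Fin (suc m)) (x≡1+k : toℕ x ≡ suc k) where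

  k≤m : k ≤ m
  k≤m = ≤-trans (n≤1+n k) (subst (_≤ m) x≡1+k (toℕ≤pred[n] x))

  P : Basis k
  P = prefix A k k≤m

  in-prefix : ∀ i → elt A i < elt A x → Σ (Fin (suc k)) λ i' → elt P i' ≡ elt A i
  in-prefix i ai<ax = fromℕ< i<1+k , cong (elt A) (toℕ-injective toℕ-agrees)
    where
    i<1+k : toℕ i < suc k
    i<1+k = subst (toℕ i <_) x≡1+k (elt-reflects-< A ai<ax)
    toℕ-agrees : toℕ (inject≤ (fromℕ< i<1+k) (s≤s k≤m)) ≡ toℕ i
    toℕ-agrees = trans (toℕ-inject≤ _ _) (toℕ-fromℕ< i<1+k)

  -- Both summands of a number below a_x are below a_x, so lie in P.
  prefix-covers : (∀ c → c < elt A x → InSumset A c) → ∀ c → c < elt A x → InSumset P c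
  prefix-covers covers c c<ax with covers c c<ax
  ... | i , j , ai+aj≡c
      with in-prefix i (≤-<-trans (subst (elt A i ≤_) ai+aj≡c (m≤m+n _ _)) c<ax)
         | in-prefix j (≤-<-trans (subst (elt A j ≤_) ai+aj≡c (m≤n+m _ _)) c<ax)
  ...    | i' , pi'≡ai | j' , pj'≡aj = i' , j' , trans (cong₂ _+_ pi'≡ai pj'≡aj) ai+aj≡c

  element-bound : Full A → ∀ {N} → IsN2 k N → elt A x ≤ suc N
  element-bound full = below-range-bound P (prefix-covers covers-below-ax)
    where
    covers-below-ax : ∀ c → c < elt A x → InSumset A c
    covers-below-ax c c<ax =
      full c (≤-trans (<⇒≤ c<ax) (≤-trans (elt≤top A x) (m≤m+n (top A) _)))

open PrefixBound using (element-bound)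

reflect : ∀ {m} → Basis m → Basis m
reflect {m} A = record
  { elt        = λ i → top A ∸ elt A (opposite i)
  ; elt-zero   = n∸n≡0 (top A)
  ; increasing = λ i j i<j → ∸-monoʳ-< (increasing A (opposite j) (opposite i) (opposite-< i<j))
                                        (elt≤top A (opposite i))
  }
  where
  opposite-< : ∀ {i j : Fin (suc m)} → toℕ i < toℕ j → toℕ (opposite j) < toℕ (opposite i)
  opposite-< {i} {j} i<j =
    subst₂ _<_ (sym (opposite-prop j)) (sym (opposite-prop i)) (∸-monoʳ-< i<j (toℕ≤pred[n] j))

reflect-elt : ∀ {m} (A : Basis m) (i : Fin (suc m)) → elt (reflect A) (opposite i) ≡ top A ∸ elt A i
reflect-elt A i = cong (λ z → top A ∸ elt A z) (opposite-involutive i)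

reflect-top : ∀ {m} (A : Basis m) → top (reflect A) ≡ top A
reflect-top {m} A = begin
  top A ∸ elt A (opposite (fromℕ m)) ≡⟨ cong (λ z → top A ∸ elt A z) opposite-top≡zero ⟩
  top A ∸ elt A Fin.zero             ≡⟨ cong (top A ∸_) (elt-zero A) ⟩
  top A                              ∎
  where
  open ≡-Reasoning
  opposite-top≡zero : opposite (fromℕ m) ≡ Fin.zero
  opposite-top≡zero =
    toℕ-injective (trans (opposite-prop (fromℕ m)) (trans (cong (m ∸_) (toℕ-fromℕ m)) (n∸n≡0 m)))

sum-of-differences : ∀ {t x y} → x ≤ t → y ≤ t → (t ∸ x) + (t ∸ y) ≡ (t + t) ∸ (x + y)
sum-of-differences {t} {x} {y} x≤t y≤t = sym (begin
  (t + t) ∸ (x + y) ≡⟨ sym (∸-+-assoc (t + t) x y) ⟩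
  ((t + t) ∸ x) ∸ y ≡⟨ cong (_∸ y) (+-∸-comm t x≤t) ⟩
  ((t ∸ x) + t) ∸ y ≡⟨ +-∸-assoc (t ∸ x) y≤t ⟩
  (t ∸ x) + (t ∸ y) ∎)
  where open ≡-Reasoning

-- The reflection of a full basis is full: c = (t - a_i) + (t - a_j)
-- whenever 2t - c = a_i + a_j.
reflect-full : ∀ {m} (A : Basis m) → Full A → Full (reflect A)
reflect-full A full c c≤2t′ with full (2 * top A ∸ c) (m∸n≤m _ c)
... | i , j , ai+aj≡2t-c = opposite i , opposite j , (begin
  elt (reflect A) (opposite i) + elt (reflect A) (opposite j)
    ≡⟨ cong₂ _+_ (reflect-elt A i) (reflect-elt A j) ⟩
  (t ∸ elt A i) + (t ∸ elt A j) ≡⟨ sum-of-differences (elt≤top A i) (elt≤top A j) ⟩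
  (t + t) ∸ (elt A i + elt A j) ≡⟨ cong₂ _∸_ (cong (t +_) (sym (+-identityʳ t))) ai+aj≡2t-c ⟩
  2 * t ∸ (2 * t ∸ c)           ≡⟨ m∸[m∸n]≡n (subst (λ z → c ≤ 2 * z) (reflect-top A) c≤2t′) ⟩
  c                             ∎)
  where
  open ≡-Reasoning
  t = top A

-- For a full basis of length (k + 1) + (j + 1), the gap from the element at
-- position k + 1 to the top is at most n₂(j) + 1: it is the element at
-- position j + 1 of the reflected basis.
suffix-bound : ∀ {k j} (A : Basis (suc k + suc j)) → Full A →
  (x : Fin (suc (suc k + suc j))) → toℕ x ≡ suc k →
  ∀ {N} → IsN2 j N → top A ∸ elt A x ≤ suc N
suffix-bound {k} {j} A full x x≡1+k {N} isN =
  subst (_≤ suc N) (reflect-elt A x)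
    (element-bound (reflect A) (opposite x) opposite-x≡1+j (reflect-full A full) isN)
  where
  opposite-x≡1+j : toℕ (opposite x) ≡ suc j
  opposite-x≡1+j = trans (opposite-prop x) (trans (cong (suc k + suc j ∸_) x≡1+k) (m+n∸m≡n (suc k) (suc j)))

extremal-restricted : ∀ {m s} → IsN2* m s → Σ (Basis m) λ A → Full A × s ≤ 2 * top A
extremal-restricted {s = s} ((A , restricted , rangeA@(coversA , _)) , _) =
  A , (λ k k≤2t → coversA k (≤-trans k≤2t (restricted s rangeA))) , sumset≤2top A (coversA s ≤-refl)

split-bound : ∀ {k j s u v} → IsN2* (suc k + suc j) s → IsN2 k u → IsN2 j v →
  s ≤ 2 * (suc u + suc v)
split-bound {k} {j} {s} {u} {v} isS isU isV with extremal-restricted isS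
... | A , full , s≤2t = ≤-trans s≤2t (*-monoʳ-≤ 2 (begin
  top A                           ≡⟨ sym (m+[n∸m]≡n (elt≤top A x)) ⟩
  elt A x + (top A ∸ elt A x)     ≤⟨ +-mono-≤ (element-bound A x x≡1+k full isU)
                                              (suffix-bound A full x x≡1+k isV) ⟩
  suc u + suc v                   ∎))
  where
  open ≤-Reasoning
  x : Fin (suc (suc k + suc j))
  1+k<1+m : suc k < suc (suc k + suc j)
  1+k<1+m = s≤s (m≤m+n (suc k) (suc j))
  x = fromℕ< 1+k<1+m
  x≡1+k : toℕ x ≡ suc k
  x≡1+k = toℕ-fromℕ< 1+k<1+m

even-split : ∀ r → 2 * suc r ≡ suc r + suc r
even-split = solve-∀

odd-split : ∀ r → 2 * suc r + 1 ≡ suc r + suc (suc r)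
odd-split = solve-∀

even-bound : ∀ a → 2 * (suc a + suc a) ≡ 4 * a + 4
even-bound = solve-∀

odd-bound : ∀ a b → 2 * (suc a + suc b) ≡ 2 * a + 2 * b + 4
odd-bound = solve-∀

corollary7 : ∀ (r : ℕ) → 1 < r →
    ∀ (a b s t : ℕ) →
    IsN2 (r ∸ 1) a → IsN2 r b → IsN2* (2 * r) s → IsN2* (2 * r + 1) t →
    (s ≤ 4 * a + 4) × (t ≤ 2 * a + 2 * b + 4)
corollary7 (suc r) _ a b s t isA isB isS isT =
    subst (s ≤_) (even-bound a)
      (split-bound (subst (λ m → IsN2* m s) (even-split r) isS) isA isA)
  , subst (t ≤_) (odd-bound a b)
      (split-bound (subst (λ m → IsN2* m t) (odd-split r) isT) isA isB)
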